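{- Let $G,H$ be graphs. The map $\phi:\pi_{/\sim}(G\times H)\to\pi_{/\sim}(G)\times\pi_{/\sim}(H)$ sending $[W]$ to $([W|_G],[W|_H])$, for any walk $W$ in $G\times H$, is well defined and is an injective groupoid homomorphism.
   Context: All graphs are finite, simple, loopless. $G\times H$ is the tensor product: vertices $V(G)\times V(H)$, $(g_0,h_0)\sim(g_1,h_1)$ adjacent iff $g_0g_1\in E(G)$ and $h_0h_1\in E(H)$. For a walk $W$ in $G\times H$, $W|_G$ and $W|_H$ are its projections (images under the coordinate projections). A walk is a sequence of oriented edges, each starting where the previous ends; $WW'$ is concatenation, $W^{ -1}$ the reverse, $\overline{W}$ the walk obtained by repeatedly deleting consecutive pairs $e,e^{ -1}$. A square is a quadruple $v_1,v_2,v_3,v_4$ with $v_1v_2,v_2v_3,v_3v_4,v_4v_1$ edges. $\sim$ is the smallest equivalence relation on walks with $W\sim\overline{W}$ and $W\,v_1v_2\,v_2v_3\,W'\sim W\,v_1v_4\,v_4v_3\,W'$ for all walks $W,W'$ and squares $v_1,\dots,v_4$. $\pi_{/\sim}(G)$ is the groupoid of classes $[W]$ with $[W]\cdot[W']=[WW']$ and $[W]^{ -1}=[W^{ -1}]$; the product groupoid $\pi_{/\sim}(G)\times\pi_{/\sim}(H)$ has componentwise operations. -}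

module Defs where

open import Data.Nat using (ℕ; _*_)
open import Data.Fin using (Fin)
open import Data.Fin.Properties using (*↔×) renaming (_≟_ to _≟F_)
open import Data.Bool using (Bool; true; false; T; _∧_)
open import Data.Bool.Properties using (T-∧)
open import Data.Product using (Σ; _×_; _,_; proj₁; proj₂)
open import Data.Product.Function.NonDependent.Propositional using (_×-↔_)
open import Function.Bundles using (_↔_; Equivalence)
open import Function.Properties.Inverse using (↔-sym; ↔-trans; ↔⇒↣)
open import Relation.Binary.PropositionalEquality using (_≡_; refl; subst)
open import Relation.Binary.Definitions using (DecidableEquality)
open import Relation.Nullary.Decidable using (via-injection; yes; no)

-- Adjacency is Bool-valued (so there is at most one edge between two
-- vertices: the graph is simple), symmetric (undirected) and irreflexive
-- (loopless); the vertex set is finite (in bijection with some Fin n).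

record Graph : Set₁ where
  field
    V      : Set
    finite : Σ ℕ (λ n → V ↔ Fin n)
    adj    : V → V → Bool
    adj-sym    : ∀ u v → adj u v ≡ adj v u
    adj-irrefl : ∀ v → adj v v ≡ false

open Graph public

Edge : (G : Graph) → V G → V G → Set
Edge G u v = T (adj G u v)

_≟V_ : {G : Graph} → DecidableEquality (V G)
_≟V_ {G} = via-injection (↔⇒↣ (proj₂ (finite G))) _≟F_

_⊗_ : Graph → Graph → Graph
G ⊗ H = record
  { V      = V G × V H
  ; finite = (proj₁ (finite G) * proj₁ (finite H))
           , ↔-trans (proj₂ (finite G) ×-↔ proj₂ (finite H)) (↔-sym *↔×)
  ; adj    = λ x y → adj G (proj₁ x) (proj₁ y) ∧ adj H (proj₂ x) (proj₂ y)
  ; adj-sym    = λ x y → sym∧ (adj-sym G (proj₁ x) (proj₁ y)) (adj-sym H (proj₂ x) (proj₂ y))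
  ; adj-irrefl = λ x → irr∧ (adj-irrefl G (proj₁ x))
  }
  where
  sym∧ : ∀ {a b c d} → a ≡ b → c ≡ d → (a ∧ c) ≡ (b ∧ d)
  sym∧ refl refl = refl
  irr∧ : ∀ {a c} → a ≡ false → (a ∧ c) ≡ false
  irr∧ refl = refl

infixr 5 _∷_
data Walk (G : Graph) : V G → V G → Set where
  []  : ∀ {v} → Walk G v v
  _∷_ : ∀ {u v w} → Edge G u v → Walk G v w → Walk G u w

module _ {G : Graph} where

  infixr 5 _++_
  _++_ : ∀ {u v w} → Walk G u v → Walk G v w → Walk G u w
  [] ++ W'      = W'
  (e ∷ W) ++ W' = e ∷ (W ++ W')

  rev : ∀ {u v} → Edge G u v → Edge G v u
  rev {u} {v} e = subst T (adj-sym G u v) e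

  _⁻¹ : ∀ {u v} → Walk G u v → Walk G v u
  [] ⁻¹      = []
  (e ∷ W) ⁻¹ = W ⁻¹ ++ (rev e ∷ [])

  -- prepend an edge to a reduced walk, cancelling a pair e e⁻¹
  push : ∀ {u v w} → Edge G u v → Walk G v w → Walk G u w
  push e [] = e ∷ []
  push {u} e (_∷_ {v = x} e' W) with _≟V_ {G} x u
  ... | yes refl = W
  ... | no _     = e ∷ e' ∷ W

  reduce : ∀ {u v} → Walk G u v → Walk G u v
  reduce []      = []
  reduce (e ∷ W) = push e (reduce W)

  infix 4 _∼_
  data _∼_ : ∀ {u v} → Walk G u v → Walk G u v → Set where
    ∼-refl  : ∀ {u v} {W : Walk G u v} → W ∼ W
    ∼-sym   : ∀ {u v} {W W' : Walk G u v} → W ∼ W' → W' ∼ W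
    ∼-trans : ∀ {u v} {W W' W'' : Walk G u v} → W ∼ W' → W' ∼ W'' → W ∼ W''
    ∼-red   : ∀ {u v} (W : Walk G u v) → W ∼ reduce W
    ∼-sq    : ∀ {u v₁ v₂ v₃ v₄ w} (W : Walk G u v₁) (W' : Walk G v₃ w)
              (e₁₂ : Edge G v₁ v₂) (e₂₃ : Edge G v₂ v₃)
              (e₁₄ : Edge G v₁ v₄) (e₄₃ : Edge G v₄ v₃) →
              (W ++ (e₁₂ ∷ e₂₃ ∷ W')) ∼ (W ++ (e₁₄ ∷ e₄₃ ∷ W'))

module _ (G H : Graph) where

  projG : ∀ {x y} → Walk (G ⊗ H) x y → Walk G (proj₁ x) (proj₁ y)
  projG []      = []
  projG (e ∷ W) = proj₁ (Equivalence.to T-∧ e) ∷ projG W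

  projH : ∀ {x y} → Walk (G ⊗ H) x y → Walk H (proj₂ x) (proj₂ y)
  projH []      = []
  projH (e ∷ W) = proj₂ (Equivalence.to T-∧ e) ∷ projH W

module Submission where

-- Homomorphism: every graph homomorphism maps backtracks to backtracks and
-- squares to squares, so its walk map respects ∼ (mapW-∼); it also preserves
-- concatenation and reversal.  The two coordinate projections are such maps.
--
-- Injectivity: a walk of G × H is determined by its projections (proj-ext), and
-- coordinate walks of equal length zip to a walk of G × H.  Fixing an anchor
-- edge at the endpoint, walks are compared through their projections padded
-- with backtracks along the anchor (module Padding).  Every generator of ∼ in
-- the G-coordinate lifts to ∼ in G × H with the H-coordinate fixed: a square
-- lifts to a square, a backtrack is slid by squares to the anchor where it
-- becomes padding, and padding is cancelled in pairs; length parity, an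
-- invariant of ∼, keeps padded pairs realisable (∼-lifts).  The H-coordinate
-- is handled by the same argument for the swapped product H × G.

open import Data.Bool.Properties using (T-∧; T-irrelevant)
open import Data.Empty using (⊥-elim)
open import Data.Nat using (ℕ; zero; suc; _+_; _≤_; pred; ⌊_/2⌋)
open import Data.Nat.Properties using (+-comm; +-suc; +-identityʳ; +-cancelˡ-≡; +-cancelʳ-≡; ≤-total; m≤n⇒∃[o]m+o≡n; n≡⌊n+n/2⌋)
open import Data.Nat.Tactic.RingSolver using (solve-∀)
open import Data.Product using (Σ; _×_; _,_; proj₁; proj₂)
open import Data.Sum using (inj₁; inj₂)
open import Function.Bundles using (Equivalence)
open import Relation.Binary.PropositionalEquality
open import Relation.Nullary using (¬_; yes; no)
open import Defs

edge-irr : ∀ {K : Graph} {u v} (e e' : Edge K u v) → e ≡ e'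
edge-irr = T-irrelevant

module _ {K : Graph} where

  ++-assoc : ∀ {a b c d} (A : Walk K a b) (B : Walk K b c) (C : Walk K c d) →
             (A ++ B) ++ C ≡ A ++ (B ++ C)
  ++-assoc []      B C = refl
  ++-assoc (e ∷ A) B C = cong (e ∷_) (++-assoc A B C)

  ++-identityʳ : ∀ {a b} (A : Walk K a b) → A ++ [] ≡ A
  ++-identityʳ []      = refl
  ++-identityʳ (e ∷ A) = cong (e ∷_) (++-identityʳ A)

  ∷-injective : ∀ {a p p' b} {e : Edge K a p} {e' : Edge K a p'} {W : Walk K p b} {W' : Walk K p' b} →
                _≡_ {A = Walk K a b} (e ∷ W) (e' ∷ W') → Σ (p ≡ p') λ { refl → W ≡ W' }
  ∷-injective refl = refl , refl

  len : ∀ {a b} → Walk K a b → ℕ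
  len []      = 0
  len (e ∷ W) = suc (len W)

  len-++ : ∀ {a b c} (A : Walk K a b) (B : Walk K b c) → len (A ++ B) ≡ len A + len B
  len-++ []      B = refl
  len-++ (e ∷ A) B = cong suc (len-++ A B)

  ≡⇒∼ : ∀ {u v} {W W' : Walk K u v} → W ≡ W' → W ∼ W'
  ≡⇒∼ refl = ∼-refl

  data Reduced : ∀ {u v} → Walk K u v → Set where
    []-red  : ∀ {u} → Reduced ([] {v = u})
    [-]-red : ∀ {u v} {e : Edge K u v} → Reduced (e ∷ [])
    ∷∷-red  : ∀ {u v x w} {e : Edge K u v} {e' : Edge K v x} {W : Walk K x w} →
              ¬ (x ≡ u) → Reduced (e' ∷ W) → Reduced (e ∷ e' ∷ W)

  tail-reduced : ∀ {u v w} {e : Edge K u v} {W : Walk K v w} → Reduced (e ∷ W) → Reduced W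
  tail-reduced [-]-red      = []-red
  tail-reduced (∷∷-red _ r) = r

  push-reduced : ∀ {u v w} (e : Edge K u v) (R : Walk K v w) → Reduced R → Reduced (push e R)
  push-reduced e [] _ = [-]-red
  push-reduced {u} e (_∷_ {v = x} e' W) r with _≟V_ {K} x u
  ... | yes refl = tail-reduced r
  ... | no  x≢u  = ∷∷-red x≢u r

  reduce-reduced : ∀ {u v} (W : Walk K u v) → Reduced (reduce W)
  reduce-reduced []      = []-red
  reduce-reduced (e ∷ W) = push-reduced e (reduce W) (reduce-reduced W)

  reduce-fixes-reduced : ∀ {u v} (R : Walk K u v) → Reduced R → reduce R ≡ R
  reduce-fixes-reduced []      _ = refl
  reduce-fixes-reduced (e ∷ []) _ = refl
  reduce-fixes-reduced {u} (e ∷ (_∷_ {v = x} e' W)) (∷∷-red x≢u r)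
    rewrite reduce-fixes-reduced (e' ∷ W) r with _≟V_ {K} x u
  ... | yes refl = ⊥-elim (x≢u refl)
  ... | no  _    = refl

  push-push : ∀ {u v w} (e : Edge K u v) (e' : Edge K v u) (R : Walk K u w) →
              Reduced R → push e (push e' R) ≡ R
  push-push {u} e e' [] _ with _≟V_ {K} u u
  ... | yes refl = refl
  ... | no  u≢u  = ⊥-elim (u≢u refl)
  push-push {u} {v} e e' (_∷_ {v = y} e'' W) r with _≟V_ {K} y v
  push-push {u} {v} e e' (_∷_ {v = y} e'' []) r | yes refl = cong (_∷ []) (edge-irr {K} e e'')
  push-push {u} {v} e e' (_∷_ {v = y} e'' (_∷_ {v = z} e₃ W)) r | yes refl with _≟V_ {K} z u
  push-push {u} {v} e e' (_∷_ {v = y} e'' (_∷_ {v = z} e₃ W)) (∷∷-red z≢u _) | yes refl | yes refl =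
    ⊥-elim (z≢u refl)
  ... | no _ = cong (_∷ e₃ ∷ W) (edge-irr {K} e e'')
  push-push {u} {v} e e' (_∷_ {v = y} e'' W) r | no _ with _≟V_ {K} u u
  ... | yes refl = refl
  ... | no  u≢u  = ⊥-elim (u≢u refl)

  reduce-suffix : ∀ {u v w} (A : Walk K u v) (B : Walk K v w) →
                  reduce (A ++ B) ≡ reduce (A ++ reduce B)
  reduce-suffix []      B = sym (reduce-fixes-reduced (reduce B) (reduce-reduced B))
  reduce-suffix (a ∷ A) B = cong (push a) (reduce-suffix A B)

  cancel : ∀ {a u v w} (X : Walk K a u) (e : Edge K u v) (e' : Edge K v u) (Y : Walk K u w) →
           (X ++ e ∷ e' ∷ Y) ∼ (X ++ Y)
  cancel X e e' Y = ∼-trans (∼-red _) (∼-trans (≡⇒∼ same-reduction) (∼-sym (∼-red _)))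
    where
    open ≡-Reasoning
    same-reduction : reduce (X ++ e ∷ e' ∷ Y) ≡ reduce (X ++ Y)
    same-reduction = begin
      reduce (X ++ e ∷ e' ∷ Y)                    ≡⟨ reduce-suffix X (e ∷ e' ∷ Y) ⟩
      reduce (X ++ push e (push e' (reduce Y)))   ≡⟨ cong (λ R → reduce (X ++ R))
                                                        (push-push e e' (reduce Y) (reduce-reduced Y)) ⟩
      reduce (X ++ reduce Y)                      ≡⟨ sym (reduce-suffix X Y) ⟩
      reduce (X ++ Y)                             ∎

  infix 4 _⇝_
  data _⇝_ : ∀ {a b} → Walk K a b → Walk K a b → Set where
    done : ∀ {a b} {W : Walk K a b} → W ⇝ W
    step : ∀ {a u v b} (X : Walk K a u) (e : Edge K u v) (e' : Edge K v u) (Y : Walk K u b)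
             {W' : Walk K a b} → (X ++ Y) ⇝ W' → (X ++ e ∷ e' ∷ Y) ⇝ W'

  ⇝-trans : ∀ {a b} {W W' W'' : Walk K a b} → W ⇝ W' → W' ⇝ W'' → W ⇝ W''
  ⇝-trans done               d' = d'
  ⇝-trans (step X e e' Y d) d' = step X e e' Y (⇝-trans d d')

  ⇝-∷ : ∀ {a u b} (e : Edge K a u) {W W' : Walk K u b} → W ⇝ W' → (e ∷ W) ⇝ (e ∷ W')
  ⇝-∷ e done               = done
  ⇝-∷ e (step X f f' Y d) = step (e ∷ X) f f' Y (⇝-∷ e d)

  ⇝-push : ∀ {u v w} (e : Edge K u v) (R : Walk K v w) → (e ∷ R) ⇝ push e R
  ⇝-push e [] = done
  ⇝-push {u} e (_∷_ {v = x} e' W) with _≟V_ {K} x u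
  ... | yes refl = step [] e e' W done
  ... | no  _    = done

  ⇝-reduce : ∀ {u v} (W : Walk K u v) → W ⇝ reduce W
  ⇝-reduce []      = done
  ⇝-reduce (e ∷ W) = ⇝-trans (⇝-∷ e (⇝-reduce W)) (⇝-push e (reduce W))

  ⇝⇒∼ : ∀ {a b} {W W' : Walk K a b} → W ⇝ W' → W ∼ W'
  ⇝⇒∼ done               = ∼-refl
  ⇝⇒∼ (step X e e' Y d) = ∼-trans (cancel X e e' Y) (⇝⇒∼ d)

  ⇝-len : ∀ {a b} {W W' : Walk K a b} → W ⇝ W' → Σ ℕ λ d → len W ≡ len W' + (d + d)
  ⇝-len done = 0 , sym (+-identityʳ _)
  ⇝-len (step X e e' Y {W'} d) with ⇝-len d
  ... | n , eq = suc n , (begin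
    len (X ++ e ∷ e' ∷ Y)          ≡⟨ len-++ X (e ∷ e' ∷ Y) ⟩
    len X + suc (suc (len Y))      ≡⟨ two-more (len X) (len Y) ⟩
    suc (suc (len X + len Y))      ≡⟨ cong (λ m → suc (suc m)) (trans (sym (len-++ X Y)) eq) ⟩
    suc (suc (len W' + (n + n)))   ≡⟨ two-more' (len W') n ⟩
    len W' + (suc n + suc n)       ∎)
    where
    open ≡-Reasoning
    two-more : ∀ x y → x + suc (suc y) ≡ suc (suc (x + y))
    two-more = solve-∀
    two-more' : ∀ w n → suc (suc (w + (n + n))) ≡ w + (suc n + suc n)
    two-more' = solve-∀

  ∷-cong : ∀ {u v w} (e : Edge K u v) {W W' : Walk K v w} → W ∼ W' → (e ∷ W) ∼ (e ∷ W')
  ∷-cong e ∼-refl                        = ∼-refl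
  ∷-cong e (∼-sym p)                     = ∼-sym (∷-cong e p)
  ∷-cong e (∼-trans p q)                 = ∼-trans (∷-cong e p) (∷-cong e q)
  ∷-cong e (∼-red W)                     = ⇝⇒∼ (⇝-∷ e (⇝-reduce W))
  ∷-cong e (∼-sq W W' e₁₂ e₂₃ e₁₄ e₄₃) = ∼-sq (e ∷ W) W' e₁₂ e₂₃ e₁₄ e₄₃

-- m ≡ᵖ n : m and n have the same parity, witnessed by even offsets m + 2p = n + 2q.
infix 4 _≡ᵖ_
_≡ᵖ_ : ℕ → ℕ → Set
m ≡ᵖ n = Σ ℕ λ p → Σ ℕ λ q → m + (p + p) ≡ n + (q + q)

≡ᵖ-trans : ∀ {m n o} → m ≡ᵖ n → n ≡ᵖ o → m ≡ᵖ o
≡ᵖ-trans {m} {n} {o} (p , q , eq) (p' , q' , eq') = p + p' , q + q' , (begin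
  m + ((p + p') + (p + p'))     ≡⟨ regroup m p p' ⟩
  (m + (p + p)) + (p' + p')     ≡⟨ cong (_+ (p' + p')) eq ⟩
  (n + (q + q)) + (p' + p')     ≡⟨ swap-offsets n q p' ⟩
  (n + (p' + p')) + (q + q)     ≡⟨ cong (_+ (q + q)) eq' ⟩
  (o + (q' + q')) + (q + q)     ≡⟨ sym (regroup o q' q) ⟩
  o + ((q' + q) + (q' + q))     ≡⟨ cong (λ r → o + (r + r)) (+-comm q' q) ⟩
  o + ((q + q') + (q + q'))     ∎)
  where
  open ≡-Reasoning
  regroup : ∀ x a b → x + ((a + b) + (a + b)) ≡ (x + (a + a)) + (b + b)
  regroup = solve-∀
  swap-offsets : ∀ x a b → (x + (a + a)) + (b + b) ≡ (x + (b + b)) + (a + a)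
  swap-offsets = solve-∀

∼-parity : ∀ {K : Graph} {u v} {W W' : Walk K u v} → W ∼ W' → len W ≡ᵖ len W'
∼-parity ∼-refl = 0 , 0 , refl
∼-parity (∼-sym p) with ∼-parity p
... | a , b , eq = b , a , sym eq
∼-parity {W = W} {W'} (∼-trans {W' = W''} p q) =
  ≡ᵖ-trans {len W} {len W''} {len W'} (∼-parity p) (∼-parity q)
∼-parity (∼-red W) with ⇝-len (⇝-reduce W)
... | d , eq = 0 , d , trans (+-identityʳ _) eq
∼-parity (∼-sq W W' _ _ _ _) = 0 , 0 , cong (_+ 0) (trans (len-++ W _) (sym (len-++ W _)))

record Hom (A B : Graph) : Set where
  field
    vmap : V A → V B
    emap : ∀ {u v} → Edge A u v → Edge B (vmap u) (vmap v)
open Hom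

module _ {A B : Graph} (f : Hom A B) where

  mapW : ∀ {u v} → Walk A u v → Walk B (vmap f u) (vmap f v)
  mapW []      = []
  mapW (e ∷ W) = emap f e ∷ mapW W

  mapW-++ : ∀ {u v w} (W : Walk A u v) (W' : Walk A v w) → mapW (W ++ W') ≡ mapW W ++ mapW W'
  mapW-++ []      W' = refl
  mapW-++ (e ∷ W) W' = cong (emap f e ∷_) (mapW-++ W W')

  len-mapW : ∀ {u v} (W : Walk A u v) → len (mapW W) ≡ len W
  len-mapW []      = refl
  len-mapW (e ∷ W) = cong suc (len-mapW W)

  mapW-⁻¹ : ∀ {u v} (W : Walk A u v) → mapW (W ⁻¹) ≡ (mapW W) ⁻¹
  mapW-⁻¹ []      = refl
  mapW-⁻¹ (e ∷ W) = trans (mapW-++ (W ⁻¹) _)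
                          (cong₂ _++_ (mapW-⁻¹ W) (cong (_∷ []) (edge-irr {B} _ _)))

  mapW-⇝ : ∀ {u v} {W W' : Walk A u v} → W ⇝ W' → mapW W ⇝ mapW W'
  mapW-⇝ done = done
  mapW-⇝ (step X e e' Y d) rewrite mapW-++ X (e ∷ e' ∷ Y) =
    step (mapW X) (emap f e) (emap f e') (mapW Y) (subst (_⇝ _) (mapW-++ X Y) (mapW-⇝ d))

  -- A homomorphism maps backtracks to backtracks and squares to squares,
  -- so its walk map respects ∼.
  mapW-∼ : ∀ {u v} {W W' : Walk A u v} → W ∼ W' → mapW W ∼ mapW W'
  mapW-∼ ∼-refl        = ∼-refl
  mapW-∼ (∼-sym p)     = ∼-sym (mapW-∼ p)
  mapW-∼ (∼-trans p q) = ∼-trans (mapW-∼ p) (mapW-∼ q)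
  mapW-∼ (∼-red W)     = ⇝⇒∼ (mapW-⇝ (⇝-reduce W))
  mapW-∼ (∼-sq W W' e₁₂ e₂₃ e₁₄ e₄₃) =
    subst₂ _∼_ (sym (mapW-++ W _)) (sym (mapW-++ W _))
      (∼-sq (mapW W) (mapW W') (emap f e₁₂) (emap f e₂₃) (emap f e₁₄) (emap f e₄₃))

  module AgreesWithMapW (F : ∀ {u v} → Walk A u v → Walk B (vmap f u) (vmap f v))
                        (F≡mapW : ∀ {u v} (W : Walk A u v) → F W ≡ mapW W) where

    F-∼ : ∀ {u v} {W W' : Walk A u v} → W ∼ W' → F W ∼ F W'
    F-∼ {W = W} {W'} p = subst₂ _∼_ (sym (F≡mapW W)) (sym (F≡mapW W')) (mapW-∼ p)

    F-++ : ∀ {u v w} (W : Walk A u v) (W' : Walk A v w) → F (W ++ W') ∼ (F W ++ F W')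
    F-++ W W' = ≡⇒∼ (trans (F≡mapW _) (trans (mapW-++ W W') (sym (cong₂ _++_ (F≡mapW W) (F≡mapW W')))))

    F-⁻¹ : ∀ {u v} (W : Walk A u v) → F (W ⁻¹) ∼ (F W) ⁻¹
    F-⁻¹ W = ≡⇒∼ (trans (F≡mapW _) (trans (mapW-⁻¹ W) (cong _⁻¹ (sym (F≡mapW W)))))

π₁ : ∀ G H → Hom (G ⊗ H) G
π₁ G H = record { vmap = proj₁ ; emap = λ e → proj₁ (Equivalence.to T-∧ e) }

π₂ : ∀ G H → Hom (G ⊗ H) H
π₂ G H = record { vmap = proj₂ ; emap = λ e → proj₂ (Equivalence.to T-∧ e) }

pairE : ∀ {G H : Graph} {g g' h h'} → Edge G g g' → Edge H h h' → Edge (G ⊗ H) (g , h) (g' , h')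
pairE e f = Equivalence.from T-∧ (e , f)

swap : ∀ G H → Hom (G ⊗ H) (H ⊗ G)
swap G H = record { vmap = λ x → proj₂ x , proj₁ x
                  ; emap = λ e → pairE {H} {G} (emap (π₂ G H) e) (emap (π₁ G H) e) }

module _ (G H : Graph) where

  projG≡mapW : ∀ {x y} (W : Walk (G ⊗ H) x y) → projG G H W ≡ mapW (π₁ G H) W
  projG≡mapW []      = refl
  projG≡mapW (e ∷ W) = cong (_ ∷_) (projG≡mapW W)

  projH≡mapW : ∀ {x y} (W : Walk (G ⊗ H) x y) → projH G H W ≡ mapW (π₂ G H) W
  projH≡mapW []      = refl
  projH≡mapW (e ∷ W) = cong (_ ∷_) (projH≡mapW W)

  π₁-swap : ∀ {x y} (W : Walk (G ⊗ H) x y) → mapW (π₁ H G) (mapW (swap G H) W) ≡ mapW (π₂ G H) W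
  π₁-swap []      = refl
  π₁-swap (e ∷ W) = cong₂ _∷_ (edge-irr {H} _ _) (π₁-swap W)

  π₂-swap : ∀ {x y} (W : Walk (G ⊗ H) x y) → mapW (π₂ H G) (mapW (swap G H) W) ≡ mapW (π₁ G H) W
  π₂-swap []      = refl
  π₂-swap (e ∷ W) = cong₂ _∷_ (edge-irr {G} _ _) (π₂-swap W)

  swap-swap : ∀ {x y} (W : Walk (G ⊗ H) x y) → mapW (swap H G) (mapW (swap G H) W) ≡ W
  swap-swap []      = refl
  swap-swap (e ∷ W) = cong₂ _∷_ (edge-irr {G ⊗ H} _ _) (swap-swap W)

module Coordinates (G H : Graph) where

  K : Graph
  K = G ⊗ H

  pG : ∀ {x y} → Walk K x y → Walk G (proj₁ x) (proj₁ y)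
  pG = mapW (π₁ G H)

  pH : ∀ {x y} → Walk K x y → Walk H (proj₂ x) (proj₂ y)
  pH = mapW (π₂ G H)

  zip : ∀ {g g' h h'} (A : Walk G g g') (B : Walk H h h') → len A ≡ len B → Walk K (g , h) (g' , h')
  zip []      []      _  = []
  zip (e ∷ A) (f ∷ B) eq = pairE {G} {H} e f ∷ zip A B (cong pred eq)

  pG-zip : ∀ {g g' h h'} (A : Walk G g g') (B : Walk H h h') (eq : len A ≡ len B) → pG (zip A B eq) ≡ A
  pG-zip []      []      _  = refl
  pG-zip (e ∷ A) (f ∷ B) eq = cong₂ _∷_ (edge-irr {G} _ _) (pG-zip A B _)

  pH-zip : ∀ {g g' h h'} (A : Walk G g g') (B : Walk H h h') (eq : len A ≡ len B) → pH (zip A B eq) ≡ B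
  pH-zip []      []      _  = refl
  pH-zip (e ∷ A) (f ∷ B) eq = cong₂ _∷_ (edge-irr {H} _ _) (pH-zip A B _)

  proj-ext : ∀ {x y} (Z Z' : Walk K x y) → pG Z ≡ pG Z' → pH Z ≡ pH Z' → Z ≡ Z'
  proj-ext []      []      _  _  = refl
  proj-ext (_∷_ {v = g , h} e Z) (_∷_ {v = g' , h'} e' Z') eqG eqH
    with ∷-injective eqG | ∷-injective eqH
  ... | refl , eqG' | refl , eqH' = cong₂ _∷_ (edge-irr {K} e e') (proj-ext Z Z' eqG' eqH')

  lift-square : ∀ {x y v₁ v₂ v₃ v₄} (W : Walk G (proj₁ x) v₁)
                (e₁₂ : Edge G v₁ v₂) (e₂₃ : Edge G v₂ v₃) (e₁₄ : Edge G v₁ v₄) (e₄₃ : Edge G v₄ v₃)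
                (T : Walk G v₃ (proj₁ y)) (Z : Walk K x y) → pG Z ≡ W ++ e₁₂ ∷ e₂₃ ∷ T →
                Σ (Walk K x y) λ Z₁ → (Z ∼ Z₁) × (pH Z₁ ≡ pH Z) × (pG Z₁ ≡ W ++ e₁₄ ∷ e₄₃ ∷ T)
  lift-square [] e₁₂ e₂₃ e₁₄ e₄₃ T (z ∷ z' ∷ Z) refl =
    Z₁ , ∼-sq [] Z z z' _ _ , cong₂ _∷_ (edge-irr {H} _ _) (cong₂ _∷_ (edge-irr {H} _ _) refl)
       , cong₂ _∷_ (edge-irr {G} _ _) (cong₂ _∷_ (edge-irr {G} _ _) refl)
    where
    Z₁ = pairE {G} {H} e₁₄ (emap (π₂ G H) z) ∷ pairE {G} {H} e₄₃ (emap (π₂ G H) z') ∷ Z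
  lift-square (w ∷ W) e₁₂ e₂₃ e₁₄ e₄₃ T (_∷_ {v = g , h} z Z) eq with ∷-injective eq
  ... | refl , eq' with lift-square W e₁₂ e₂₃ e₁₄ e₄₃ T Z eq'
  ... | Z₁ , Z∼Z₁ , eqH , eqG = z ∷ Z₁ , ∷-cong z Z∼Z₁ , cong (_ ∷_) eqH
                              , cong₂ _∷_ (edge-irr {G} _ _) eqG

  -- A backtrack e e' in the G-coordinate can be slid, by lifted squares, to the
  -- end of the walk, where it becomes a backtrack n n⁻¹ along any edge n there.
  slide-backtrack : ∀ {x y u v g'} (X : Walk G (proj₁ x) u) (e : Edge G u v) (e' : Edge G v u)
                    (T : Walk G u (proj₁ y)) (n : Edge G (proj₁ y) g') (Z : Walk K x y) →
                    pG Z ≡ X ++ e ∷ e' ∷ T →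
                    Σ (Walk K x y) λ Z₁ → (Z ∼ Z₁) × (pH Z₁ ≡ pH Z) × (pG Z₁ ≡ X ++ T ++ n ∷ rev {G = G} n ∷ [])
  slide-backtrack X e e' []      n Z eq = lift-square X e e' n (rev {G = G} n) [] Z eq
  slide-backtrack X e e' (t ∷ T) n Z eq with lift-square X e e' t (rev {G = G} t) (t ∷ T) Z eq
  ... | Z₁ , Z∼Z₁ , eqH₁ , eqG₁
    with slide-backtrack (X ++ t ∷ []) (rev {G = G} t) t T n Z₁ (trans eqG₁ (sym (++-assoc X (t ∷ []) _)))
  ... | Z₂ , Z₁∼Z₂ , eqH₂ , eqG₂ =
    Z₂ , ∼-trans Z∼Z₁ Z₁∼Z₂ , trans eqH₂ eqH₁ , trans eqG₂ (++-assoc X (t ∷ []) _)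

double-injective : ∀ p q → p + p ≡ q + q → p ≡ q
double-injective p q eq = trans (n≡⌊n+n/2⌋ p) (trans (cong ⌊_/2⌋ eq) (sym (n≡⌊n+n/2⌋ q)))

offsets-determined : ∀ {x y k l k' l'} o → x + (k + k) ≡ y + (l + l) →
                     x + (k' + k') ≡ y + (l' + l') → k' ≡ o + k → l' ≡ o + l
offsets-determined {x} {y} {k} {l} {k'} {l'} o eq eq' refl =
  double-injective l' (o + l) (+-cancelˡ-≡ y _ _ (begin
    y + (l' + l')                ≡⟨ sym eq' ⟩
    x + ((o + k) + (o + k))      ≡⟨ regroup x o k ⟩
    (x + (k + k)) + (o + o)      ≡⟨ cong (_+ (o + o)) eq ⟩
    (y + (l + l)) + (o + o)      ≡⟨ sym (regroup y o l) ⟩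
    y + ((o + l) + (o + l))      ∎))
  where
  open ≡-Reasoning
  regroup : ∀ z a b → z + ((a + b) + (a + b)) ≡ (z + (b + b)) + (a + a)
  regroup = solve-∀

backtracks : ∀ {K : Graph} {s t} → Edge K s t → ℕ → Walk K s s
backtracks     n zero    = []
backtracks {K} n (suc k) = n ∷ rev {G = K} n ∷ backtracks {K} n k

len-backtracks : ∀ {K : Graph} {s t} (n : Edge K s t) k → len (backtracks {K} n k) ≡ k + k
len-backtracks     n zero    = refl
len-backtracks {K} n (suc k) = cong suc (trans (cong suc (len-backtracks {K} n k)) (sym (+-suc k k)))

backtracks-snoc : ∀ {K : Graph} {a s t} (c : Walk K a s) (n : Edge K s t) k {P : Walk K a s} →
                  P ≡ c ++ backtracks {K} n k → (e₁ : Edge K s t) (e₂ : Edge K t s) →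
                  P ++ e₁ ∷ e₂ ∷ [] ≡ c ++ backtracks {K} n (suc k)
backtracks-snoc {K} c n k refl e₁ e₂ rewrite edge-irr {K} e₁ n | edge-irr {K} e₂ (rev {G = K} n) =
  trans (++-assoc c (backtracks {K} n k) _) (cong (c ++_) (snoc k))
  where
  snoc : ∀ k → backtracks {K} n k ++ n ∷ rev {G = K} n ∷ [] ≡ backtracks {K} n (suc k)
  snoc zero    = refl
  snoc (suc k) = cong (λ B → n ∷ rev {G = K} n ∷ B) (snoc k)

-- Walks of G × H ending at an anchor (gs, hs), compared through their projections
-- padded at the end with backtracks along fixed anchor edges ng and nh.
module Padding (G H : Graph) {gs hs gn hn} (ng : Edge G gs gn) (nh : Edge H hs hn) where
  open Coordinates G H

  ys : V K
  ys = gs , hs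

  record PadsAt {x} (a : Walk G (proj₁ x) gs) (b : Walk H (proj₂ x) hs) (k l : ℕ) (Z : Walk K x ys) : Set where
    constructor padsAt
    field
      projG-padded : pG Z ≡ a ++ backtracks ng k
      projH-padded : pH Z ≡ b ++ backtracks nh l
  open PadsAt

  Pads : ∀ {x} → Walk G (proj₁ x) gs → Walk H (proj₂ x) hs → Walk K x ys → Set
  Pads a b Z = Σ ℕ λ k → Σ ℕ λ l → PadsAt a b k l Z

  PadsAt-len : ∀ {x} {a : Walk G (proj₁ x) gs} {b : Walk H (proj₂ x) hs} {k l Z} →
               PadsAt a b k l Z → len a + (k + k) ≡ len b + (l + l)
  PadsAt-len {a = a} {b} {k} {l} {Z} (padsAt eqG eqH) = begin
    len a + (k + k)                    ≡⟨ sym (padded-len a ng k) ⟩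
    len (a ++ backtracks ng k)         ≡⟨ cong len (sym eqG) ⟩
    len (pG Z)                         ≡⟨ trans (len-mapW (π₁ G H) Z) (sym (len-mapW (π₂ G H) Z)) ⟩
    len (pH Z)                         ≡⟨ cong len eqH ⟩
    len (b ++ backtracks nh l)         ≡⟨ padded-len b nh l ⟩
    len b + (l + l)                    ∎
    where
    open ≡-Reasoning
    padded-len : ∀ {A : Graph} {a s t} (c : Walk A a s) (n : Edge A s t) k →
                 len (c ++ backtracks {A} n k) ≡ len c + (k + k)
    padded-len {A} c n k = trans (len-++ c (backtracks {A} n k)) (cong (len c +_) (len-backtracks {A} n k))

  realise : ∀ {x} (a : Walk G (proj₁ x) gs) (b : Walk H (proj₂ x) hs) k l →
            len a + (k + k) ≡ len b + (l + l) → Σ (Walk K x ys) (PadsAt a b k l)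
  realise a b k l eq = zip A B lengths , padsAt (pG-zip A B lengths) (pH-zip A B lengths)
    where
    A = a ++ backtracks ng k
    B = b ++ backtracks nh l
    lengths : len A ≡ len B
    lengths = trans (len-++ a _) (trans (cong (len a +_) (len-backtracks {G} ng k)) (trans eq
                (sym (trans (len-++ b _) (cong (len b +_) (len-backtracks {H} nh l))))))

  PadsAt-unique : ∀ {x} {a : Walk G (proj₁ x) gs} {b : Walk H (proj₂ x) hs} {k l} {Z Z' : Walk K x ys} →
                  PadsAt a b k l Z → PadsAt a b k l Z' → Z ≡ Z'
  PadsAt-unique {Z = Z} {Z'} (padsAt eqG eqH) (padsAt eqG' eqH') = proj-ext Z Z' (trans eqG (sym eqG')) (trans eqH (sym eqH'))

  drop-backtrack : ∀ {x} {a : Walk G (proj₁ x) gs} {b : Walk H (proj₂ x) hs} {k l} {Z : Walk K x ys} →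
                   PadsAt a b (suc k) (suc l) Z → Σ (Walk K x ys) λ Z₀ → PadsAt a b k l Z₀ × (Z ∼ Z₀)
  drop-backtrack {a = a} {b} {k} {l} {Z} P =
    Z₀ , P₀ , ∼-trans (≡⇒∼ Z≡Z₀++btK) (subst (Z₀ ++ e₁ ∷ e₂ ∷ [] ∼_) (++-identityʳ Z₀) (cancel Z₀ e₁ e₂ []))
    where
    e₁ = pairE {G} {H} ng nh
    e₂ = pairE {G} {H} (rev {G = G} ng) (rev {G = H} nh)
    shorter : ∀ {x y} → x + (suc k + suc k) ≡ y + (suc l + suc l) → x + (k + k) ≡ y + (l + l)
    shorter {x} {y} eq = +-cancelʳ-≡ 2 _ _ (trans (two-more x k) (trans eq (sym (two-more y l))))
      where
      two-more : ∀ z m → (z + (m + m)) + 2 ≡ z + (suc m + suc m)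
      two-more = solve-∀
    Z₀ : Walk K _ ys
    Z₀ = proj₁ (realise a b k l (shorter (PadsAt-len P)))
    P₀ : PadsAt a b k l Z₀
    P₀ = proj₂ (realise a b k l (shorter (PadsAt-len P)))
    Z≡Z₀++btK : Z ≡ Z₀ ++ e₁ ∷ e₂ ∷ []
    Z≡Z₀++btK = PadsAt-unique P
      (padsAt (trans (mapW-++ (π₁ G H) Z₀ _) (backtracks-snoc {G} a ng k (projG-padded P₀) _ _))
              (trans (mapW-++ (π₂ G H) Z₀ _) (backtracks-snoc {H} b nh l (projH-padded P₀) _ _)))

  shift : ∀ {x} {a : Walk G (proj₁ x) gs} {b : Walk H (proj₂ x) hs} {k l} {Z Z' : Walk K x ys} o →
          PadsAt a b k l Z → PadsAt a b (o + k) (o + l) Z' → Z ∼ Z'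
  shift zero    P P' = ≡⇒∼ (PadsAt-unique P P')
  shift (suc o) P P' with drop-backtrack P'
  ... | Z₀ , P₀ , Z'∼Z₀ = ∼-trans (shift o P P₀) (∼-sym Z'∼Z₀)

  shift-≤ : ∀ {x} {a : Walk G (proj₁ x) gs} {b : Walk H (proj₂ x) hs} {k l k' l'} {Z Z' : Walk K x ys} →
            k ≤ k' → PadsAt a b k l Z → PadsAt a b k' l' Z' → Z ∼ Z'
  shift-≤ {a = a} {b} {k} {l} {k'} {l'} {Z' = Z'} k≤k' P P' with m≤n⇒∃[o]m+o≡n k≤k'
  ... | o , k+o≡k' = shift o P (subst₂ (λ i j → PadsAt a b i j Z') k'≡o+k l'≡o+l P')
    where
    k'≡o+k : k' ≡ o + k
    k'≡o+k = trans (sym k+o≡k') (+-comm k o)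
    l'≡o+l : l' ≡ o + l
    l'≡o+l = offsets-determined {len a} {len b} o (PadsAt-len P) (PadsAt-len P') k'≡o+k

  Pads-unique : ∀ {x} {a : Walk G (proj₁ x) gs} {b : Walk H (proj₂ x) hs} {Z Z' : Walk K x ys} →
                Pads a b Z → Pads a b Z' → Z ∼ Z'
  Pads-unique (k , l , P) (k' , l' , P') with ≤-total k k'
  ... | inj₁ k≤k' = shift-≤ k≤k' P P'
  ... | inj₂ k'≤k = ∼-sym (shift-≤ k'≤k P' P)

  re-realise : ∀ {x} {a a' : Walk G (proj₁ x) gs} {b : Walk H (proj₂ x) hs} {Z : Walk K x ys} →
               Pads a b Z → len a ≡ᵖ len a' → Σ (Walk K x ys) (Pads a' b)
  re-realise {a = a} {a'} {b} (k , l , P) (p , q , eq) =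
    proj₁ realised , q + k , p + l , proj₂ realised
    where
    balanced : len a' + ((q + k) + (q + k)) ≡ len b + ((p + l) + (p + l))
    balanced = proj₂ (proj₂ (≡ᵖ-trans {len a'} {len a} {len b} (q , p , sym eq) (k , l , PadsAt-len P)))
    realised = realise a' b (q + k) (p + l) balanced

  -- Deleting a backtrack from the first coordinate: slide it to the anchor,
  -- where it becomes one more padding backtrack.
  delete-backtrack : ∀ {x u v} (X : Walk G (proj₁ x) u) (e : Edge G u v) (e' : Edge G v u)
                     (Y : Walk G u gs) {b : Walk H (proj₂ x) hs} {k l} {Z : Walk K x ys} →
                     PadsAt (X ++ e ∷ e' ∷ Y) b k l Z →
                     Σ (Walk K x ys) λ Z₁ → (Z ∼ Z₁) × PadsAt (X ++ Y) b (suc k) l Z₁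
  delete-backtrack X e e' Y {k = k} {Z = Z} (padsAt eqG eqH)
    with slide-backtrack X e e' (Y ++ backtracks {G} ng k) ng Z (trans eqG (++-assoc X (e ∷ e' ∷ Y) _))
  ... | Z₁ , Z∼Z₁ , eqH₁ , eqG₁ = Z₁ , Z∼Z₁ , padsAt (trans eqG₁ one-more-padding) (trans eqH₁ eqH)
    where
    B = backtracks {G} ng k
    S = ng ∷ rev {G = G} ng ∷ []
    one-more-padding : X ++ (Y ++ B) ++ S ≡ (X ++ Y) ++ backtracks {G} ng (suc k)
    one-more-padding = trans (sym (++-assoc X (Y ++ B) S))
                             (backtracks-snoc {G} (X ++ Y) ng k (sym (++-assoc X Y B)) ng (rev {G = G} ng))

  ⇝-lifts : ∀ {x} {a a' : Walk G (proj₁ x) gs} {b : Walk H (proj₂ x) hs} {k l} {Z Z' : Walk K x ys} →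
            a ⇝ a' → PadsAt a b k l Z → Pads a' b Z' → Z ∼ Z'
  ⇝-lifts done              P P' = Pads-unique (_ , _ , P) P'
  ⇝-lifts (step X e e' Y d) P P' with delete-backtrack X e e' Y P
  ... | Z₁ , Z∼Z₁ , P₁ = ∼-trans Z∼Z₁ (⇝-lifts d P₁ P')

  ∼-lifts : ∀ {x} {a a' : Walk G (proj₁ x) gs} {b : Walk H (proj₂ x) hs} {Z Z' : Walk K x ys} →
            a ∼ a' → Pads a b Z → Pads a' b Z' → Z ∼ Z'
  ∼-lifts ∼-refl        P P' = Pads-unique P P'
  ∼-lifts (∼-sym p)     P P' = ∼-sym (∼-lifts p P' P)
  ∼-lifts (∼-trans p q) P P' with re-realise P (∼-parity p)
  ... | Z'' , P'' = ∼-trans (∼-lifts p P P'') (∼-lifts q P'' P')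
  ∼-lifts (∼-red a) (_ , _ , P) P' = ⇝-lifts (⇝-reduce a) P P'
  ∼-lifts {Z = Z} (∼-sq W W' e₁₂ e₂₃ e₁₄ e₄₃) (k , l , padsAt eqG eqH) P'
    with lift-square W e₁₂ e₂₃ e₁₄ e₄₃ (W' ++ backtracks {G} ng k) Z (trans eqG (++-assoc W _ _))
  ... | Z₁ , Z∼Z₁ , eqH₁ , eqG₁ =
    ∼-trans Z∼Z₁ (Pads-unique (k , l , padsAt (trans eqG₁ (sym (++-assoc W _ _))) (trans eqH₁ eqH)) P')

module Injectivity (G H : Graph) where
  open Coordinates G H

  -- Walks ending at y, anchored at an edge n leaving y.  First change the
  -- G-coordinate with Padding G H, then the H-coordinate with Padding H G
  -- applied to the swapped walks, and swap back.
  anchored : ∀ {x y w} (n : Edge K y w) (W W' : Walk K x y) → pG W ∼ pG W' → pH W ∼ pH W' → W ∼ W'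
  anchored {x} {y} n W W' pg ph =
    ∼-trans (GH.∼-lifts pg (unpadded W) (proj₂ middle))
            (unswap (HG.∼-lifts ph (swapped (proj₂ middle)) (swapped (unpadded W'))))
    where
    module GH = Padding G H (emap (π₁ G H) n) (emap (π₂ G H) n)
    module HG = Padding H G (emap (π₂ G H) n) (emap (π₁ G H) n)
    unpadded : (Z : Walk K x y) → GH.Pads (pG Z) (pH Z) Z
    unpadded Z = 0 , 0 , GH.padsAt (sym (++-identityʳ _)) (sym (++-identityʳ _))
    swapped : ∀ {a : Walk G (proj₁ x) (proj₁ y)} {b : Walk H (proj₂ x) (proj₂ y)} {Z : Walk K x y} →
              GH.Pads a b Z → HG.Pads b a (mapW (swap G H) Z)
    swapped {Z = Z} (k , l , GH.padsAt eqG eqH) =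
      l , k , HG.padsAt (trans (π₁-swap G H Z) eqH) (trans (π₂-swap G H Z) eqG)
    -- an intermediate walk with G-coordinate that of W' and H-coordinate that of W
    middle : Σ (Walk K x y) (GH.Pads (pG W') (pH W))
    middle = GH.re-realise (unpadded W) (∼-parity pg)
    unswap : ∀ {Z Z' : Walk K x y} → mapW (swap G H) Z ∼ mapW (swap G H) Z' → Z ∼ Z'
    unswap {Z} {Z'} p = subst₂ _∼_ (swap-swap G H Z) (swap-swap G H Z') (mapW-∼ (swap H G) p)

  edge-at-end : ∀ {x z y} → Edge K x z → Walk K z y → Σ (V K) (Edge K y)
  edge-at-end e []       = _ , rev {G = K} e
  edge-at-end e (e' ∷ W) = edge-at-end e' W

  injective-coordinates : ∀ {x y} (W W' : Walk K x y) → pG W ∼ pG W' → pH W ∼ pH W' → W ∼ W'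
  injective-coordinates []      []       _  _  = ∼-refl
  injective-coordinates []      (e ∷ W') = anchored (proj₂ (edge-at-end e W')) [] (e ∷ W')
  injective-coordinates (e ∷ W) W'       = anchored (proj₂ (edge-at-end e W)) (e ∷ W) W'

  injective : ∀ {x y} (W W' : Walk K x y) →
              projG G H W ∼ projG G H W' → projH G H W ∼ projH G H W' → W ∼ W'
  injective W W' pg ph = injective-coordinates W W'
    (subst₂ _∼_ (projG≡mapW G H W) (projG≡mapW G H W') pg)
    (subst₂ _∼_ (projH≡mapW G H W) (projH≡mapW G H W') ph)

lemma3 : (G H : Graph) →
    -- well defined: W ∼ W' implies ([W|_G],[W|_H]) = ([W'|_G],[W'|_H])
    (∀ {x y} (W W' : Walk (G ⊗ H) x y) → W ∼ W' →
       (projG G H W ∼ projG G H W') × (projH G H W ∼ projH G H W'))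
    -- groupoid homomorphism: preserves composition
    × (∀ {x y z} (W : Walk (G ⊗ H) x y) (W' : Walk (G ⊗ H) y z) →
       (projG G H (W ++ W') ∼ (projG G H W ++ projG G H W'))
       × (projH G H (W ++ W') ∼ (projH G H W ++ projH G H W')))
    -- preserves identities
    × (∀ x → (projG G H ([] {v = x}) ∼ [])
       × (projH G H ([] {v = x}) ∼ []))
    -- preserves inverses
    × (∀ {x y} (W : Walk (G ⊗ H) x y) →
       (projG G H (W ⁻¹) ∼ (projG G H W) ⁻¹) × (projH G H (W ⁻¹) ∼ (projH G H W) ⁻¹))
    -- injective
    × (∀ {x y} (W W' : Walk (G ⊗ H) x y) →
       projG G H W ∼ projG G H W' → projH G H W ∼ projH G H W' → W ∼ W')
lemma3 G H =
    (λ W W' p → ProjG.F-∼ p , ProjH.F-∼ p)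
  , (λ W W' → ProjG.F-++ W W' , ProjH.F-++ W W')
  , (λ x → ∼-refl , ∼-refl)
  , (λ W → ProjG.F-⁻¹ W , ProjH.F-⁻¹ W)
  , Injectivity.injective G H
  where
  module ProjG = AgreesWithMapW (π₁ G H) (projG G H) (projG≡mapW G H)
  module ProjH = AgreesWithMapW (π₂ G H) (projH G H) (projH≡mapW G H)
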